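{- Let $G$ be a countable connected graph containing no alternating ray, and let $T$ be a normal spanning tree of $G$ with root $r$. Then $\mathrm{rank}_T(v)$ is defined (i.e. is some ordinal) for every vertex $v\in V(G)$.
   Context: A ray is a one-way infinite path; it is alternating if it passes through infinitely many vertices of finite degree and infinitely many vertices of infinite degree (degrees in $G$). The tree order $\leq$ of $T$ is given by $u\leq v$ iff $u$ lies on the path in $T$ from $r$ to $v$; $T$ is normal if the endpoints of every edge of $G$ are $\leq$-comparable. Let $\lfloor v\rfloor=\{u\in V(G): u\geq v\}$. The $T$-rank is defined recursively: $\mathrm{rank}_T(v)=0$ if $\lfloor v\rfloor$ consists only of vertices of finite degree or only of vertices of infinite degree. For an ordinal $\alpha>0$, a vertex $v$ of infinite (resp. finite) degree has $\mathrm{rank}_T(v)=\alpha$ if no rank smaller than $\alpha$ has been assigned to $v$, but every vertex of finite (resp. infinite) degree in $\lfloor v\rfloor\setminus\{v\}$ has been assigned a rank smaller than $\alpha$. -}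

module Defs where

open import Level using (0ℓ)
open import Data.Nat using (ℕ; suc; _≤_)
open import Data.List using (List; []; _∷_; length)
open import Data.List.Membership.Propositional using (_∈_)
open import Data.List.Relation.Unary.Unique.Propositional using (Unique)
open import Data.Product using (Σ; ∃; _×_; _,_)
open import Data.Sum using (_⊎_)
open import Relation.Nullary using (¬_)
open import Relation.Binary.PropositionalEquality using (_≡_; _≢_)
open import Function.Definitions using (Injective)

record Graph : Set₁ where
  field
    V     : Set
    E     : V → V → Set
    sym   : ∀ {x y} → E x y → E y x
    irrefl : ∀ {x} → ¬ E x x

Countable : Set → Set
Countable A = Σ (A → ℕ) λ f → Injective _≡_ _≡_ f

module _ {V : Set} (R : V → V → Set) where

  data Walk : V → V → Set where
    [] : ∀ {x} → Walk x x
    _∷_ : ∀ {x y z} → R x y → Walk y z → Walk x z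

  verts : ∀ {x y} → Walk x y → List V
  verts {x} [] = x ∷ []
  verts {x} (_ ∷ w) = x ∷ verts w

  edgeCount : ∀ {x y} → Walk x y → ℕ
  edgeCount [] = 0
  edgeCount (_ ∷ w) = suc (edgeCount w)

  Path : V → V → Set
  Path x y = Σ (Walk x y) λ w → Unique (verts w)

  Connected : Set
  Connected = ∀ x y → Path x y

  -- a cycle: an edge x–y together with a path from y back to x with at
  -- least 2 edges (so the cycle has ≥ 3 distinct vertices)
  HasCycle : Set
  HasCycle = Σ V λ x → Σ V λ y → R x y × Σ (Path y x) λ p → 2 ≤ edgeCount (Data.Product.proj₁ p)

  Acyclic : Set
  Acyclic = ¬ HasCycle

module _ (G : Graph) where
  open Graph G

  ConnectedGraph : Set
  ConnectedGraph = Connected E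

  FiniteDegree : V → Set
  FiniteDegree v = Σ (List V) λ xs → ∀ u → E v u → u ∈ xs

  InfiniteDegree : V → Set
  InfiniteDegree v = ¬ FiniteDegree v

  record Ray : Set where
    field
      seq  : ℕ → V
      inj  : Injective _≡_ _≡_ seq
      adj  : ∀ n → E (seq n) (seq (suc n))

  Alternating : Ray → Set
  Alternating ρ =
    (∀ N → Σ ℕ λ n → N ≤ n × FiniteDegree (Ray.seq ρ n)) ×
    (∀ N → Σ ℕ λ n → N ≤ n × InfiniteDegree (Ray.seq ρ n))

  NoAlternatingRay : Set
  NoAlternatingRay = ¬ (Σ Ray Alternating)

  record SpanningTree : Set₁ where
    field
      ET      : V → V → Set
      sub     : ∀ {x y} → ET x y → E x y
      symT    : ∀ {x y} → ET x y → ET y x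
      connT   : Connected ET
      acyclic : Acyclic ET

  module _ (T : SpanningTree) (r : V) where
    open SpanningTree T

    _≤T_ : V → V → Set
    u ≤T v = Σ (Path ET r v) λ p → u ∈ verts ET (Data.Product.proj₁ p)

    Normal : Set
    Normal = ∀ x y → E x y → (x ≤T y) ⊎ (y ≤T x)

    -- "rank_T(v) is defined": the least fixed point of the transfinite
    -- rank assignment (a derivation of HasRank v has an ordinal height,
    -- which is the stage at which v receives its rank).
    data HasRank : V → Set where
      rank0   : ∀ {v} →
                ((∀ u → v ≤T u → FiniteDegree u) ⊎ (∀ u → v ≤T u → InfiniteDegree u)) →
                HasRank v
      rankInf : ∀ {v} → InfiniteDegree v →
                (∀ u → v ≤T u → u ≢ v → FiniteDegree u → HasRank u) →
                HasRank v
      rankFin : ∀ {v} → FiniteDegree v →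
                (∀ u → v ≤T u → u ≢ v → InfiniteDegree u → HasRank u) →
                HasRank v

{-# OPTIONS --safe #-}
module Submission where

-- Suppose v has no rank.  Whichever of finite or infinite degree v has,
-- some vertex u strictly above v of the opposite kind has no rank either,
-- for otherwise the clause of the rank definition for v's kind applies
-- and ranks v.  Iterating gives unranked vertices v = v₀ < v₁ < v₂ < ⋯ in
-- the tree order whose degrees alternate between finite and infinite.
-- Since paths in a tree are unique, the tree paths from r to the vᵢ form
-- a strictly increasing chain of prefixes; their union is a ray of T,
-- hence of G, passing through every vᵢ, and so an alternating ray.

open import Defs
open import Level using (0ℓ)
open import Axiom.ExcludedMiddle using (ExcludedMiddle)
open import Data.Nat using (ℕ; zero; suc; _+_; _≤_; _<_; _≤′_; ≤′-refl; ≤′-step; z≤n; s≤s)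
open import Data.Nat.Properties
  using (≤-total; ≤-trans; ≤-<-trans; <-trans; n<1+n; n≤1+n; m≤m+n; m≤n+m; m<m+n; m<1+n⇒m≤n;
         +-comm; ≤⇒≤′)
open import Data.List using (List; []; _∷_; _++_; _∷ʳ_; length)
open import Data.List.Properties using (++-assoc; ++-identityʳ; length-++)
open import Data.List.Membership.Propositional using (_∈_; _∉_)
open import Data.List.Relation.Binary.Subset.Propositional using (_⊆_)
open import Data.List.Relation.Unary.Any using (here; there)
open import Data.List.Relation.Unary.All using ([]; _∷_)
import Data.List.Relation.Unary.All.Properties as All
open import Data.List.Relation.Unary.AllPairs using ([]; _∷_)
open import Data.List.Relation.Unary.Linked using (Linked; [-]; _∷_)
import Data.List.Relation.Unary.Linked as Linked
open import Data.List.Relation.Unary.Unique.Propositional using (Unique)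
open import Data.List.Relation.Unary.Unique.Propositional.Properties using (Unique[x∷xs]⇒x∉xs)
open import Data.Product using (Σ; _×_; _,_; proj₁; proj₂)
open import Data.Sum using (_⊎_; inj₁; inj₂; [_,_]′)
import Data.Sum as Sum
import Data.Product as Product
open import Data.Empty using (⊥-elim)
open import Function using (_∘_)
open import Function.Definitions using (Injective)
open import Relation.Nullary using (¬_; yes; no)
open import Relation.Nullary.Decidable using (decidable-stable)
open import Relation.Binary.PropositionalEquality
  using (_≡_; _≢_; ≢-sym; refl; sym; trans; cong; cong₂; subst; subst₂; module ≡-Reasoning)
open ≡-Reasoning

module _ {A : Set} where

  infix 4 _≼_ _≺_

  _≼_ : List A → List A → Set
  xs ≼ ys = Σ (List A) λ zs → ys ≡ xs ++ zs

  _≺_ : List A → List A → Set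
  xs ≺ ys = Σ A λ z → Σ (List A) λ zs → ys ≡ xs ++ z ∷ zs

  ≼-refl : ∀ {xs} → xs ≼ xs
  ≼-refl {xs} = [] , sym (++-identityʳ xs)

  ≼-trans : ∀ {xs ys zs} → xs ≼ ys → ys ≼ zs → xs ≼ zs
  ≼-trans {xs} (us , refl) (ws , refl) = us ++ ws , ++-assoc xs us ws

  ≺⇒≼ : ∀ {xs ys} → xs ≺ ys → xs ≼ ys
  ≺⇒≼ (z , zs , eq) = z ∷ zs , eq

  ≺⇒length< : ∀ {xs ys} → xs ≺ ys → length xs < length ys
  ≺⇒length< {xs} (z , zs , refl) =
    subst (length xs <_) (sym (length-++ xs)) (m<m+n (length xs) (s≤s z≤n))

  -- Indexing with a junk value past the end of the list.
  nth : A → List A → ℕ → A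
  nth d []       n       = d
  nth d (x ∷ xs) zero    = x
  nth d (x ∷ xs) (suc n) = nth d xs n

  module _ {d : A} where

    nth-++ˡ : ∀ xs {ys n} → n < length xs → nth d (xs ++ ys) n ≡ nth d xs n
    nth-++ˡ (x ∷ xs) {n = zero}  _       = refl
    nth-++ˡ (x ∷ xs) {n = suc n} (s≤s h) = nth-++ˡ xs h

    ≼⇒nth≡ : ∀ {xs ys n} → xs ≼ ys → n < length xs → nth d ys n ≡ nth d xs n
    ≼⇒nth≡ {xs} (zs , refl) = nth-++ˡ xs

    nth-∷ʳ-length : ∀ xs {y} → nth d (xs ∷ʳ y) (length xs) ≡ y
    nth-∷ʳ-length []       = refl
    nth-∷ʳ-length (x ∷ xs) = nth-∷ʳ-length xs

    nth∈ : ∀ xs {n} → n < length xs → nth d xs n ∈ xs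
    nth∈ (x ∷ xs) {zero}  _       = here refl
    nth∈ (x ∷ xs) {suc n} (s≤s h) = there (nth∈ xs h)

    nth-injective : ∀ {xs} → Unique xs → ∀ {m n} → m < length xs → n < length xs →
                    nth d xs m ≡ nth d xs n → m ≡ n
    nth-injective {x ∷ xs} _         {zero}  {zero}  _       _       _  = refl
    nth-injective {x ∷ xs} x!        {zero}  {suc n} _       (s≤s h) eq =
      ⊥-elim (Unique[x∷xs]⇒x∉xs x! (subst (_∈ xs) (sym eq) (nth∈ xs h)))
    nth-injective {x ∷ xs} x!        {suc m} {zero}  (s≤s h) _       eq =
      ⊥-elim (Unique[x∷xs]⇒x∉xs x! (subst (_∈ xs) eq (nth∈ xs h)))
    nth-injective {x ∷ xs} (_ ∷ xs!) {suc m} {suc n} (s≤s g) (s≤s h) eq =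
      cong suc (nth-injective xs! g h eq)

    Linked-nth : ∀ {R : A → A → Set} {xs n} → Linked R xs → suc n < length xs →
                 R (nth d xs n) (nth d xs (suc n))
    Linked-nth             [-]       (s≤s ())
    Linked-nth {n = zero}  (r ∷ _)   _       = r
    Linked-nth {n = suc n} (_ ∷ rs)  (s≤s h) = Linked-nth rs h

module PrefixLimit {A : Set} (d : A) (L : ℕ → List A)
                   (L₀-nonempty : 0 < length (L 0)) (L-≺ : ∀ k → L k ≺ L (suc k)) where

  length-L : ∀ k → k < length (L k)
  length-L zero    = L₀-nonempty
  length-L (suc k) = ≤-trans (s≤s (length-L k)) (≺⇒length< (L-≺ k))

  L-mono : ∀ {k m} → k ≤′ m → L k ≼ L m
  L-mono ≤′-refl        = ≼-refl
  L-mono (≤′-step k≤m) = ≼-trans (L-mono k≤m) (≺⇒≼ (L-≺ _))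

  limit : ℕ → A
  limit n = nth d (L n) n

  nth-L≡limit : ∀ k {n} → n < length (L k) → nth d (L k) n ≡ limit n
  nth-L≡limit k {n} n<∣Lk∣ with ≤-total k n
  ... | inj₁ k≤n = sym (≼⇒nth≡ (L-mono (≤⇒≤′ k≤n)) n<∣Lk∣)
  ... | inj₂ n≤k = ≼⇒nth≡ (L-mono (≤⇒≤′ n≤k)) (length-L n)

  limit-injective : (∀ k → Unique (L k)) → Injective _≡_ _≡_ limit
  limit-injective L! {m} {n} eq =
    nth-injective (L! k) m<∣Lk∣ n<∣Lk∣
      (trans (nth-L≡limit k m<∣Lk∣) (trans eq (sym (nth-L≡limit k n<∣Lk∣))))
    where
    k : ℕ
    k = m + n
    m<∣Lk∣ : m < length (L k)
    m<∣Lk∣ = ≤-<-trans (m≤m+n m n) (length-L k)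
    n<∣Lk∣ : n < length (L k)
    n<∣Lk∣ = ≤-<-trans (m≤n+m n m) (length-L k)

  limit-linked : ∀ {R : A → A → Set} → (∀ k → Linked R (L k)) →
                 ∀ n → R (limit n) (limit (suc n))
  limit-linked {R} L-linked n =
    subst₂ R (nth-L≡limit (suc n) (<-trans (n<1+n n) (length-L (suc n))))
             (nth-L≡limit (suc n) (length-L (suc n)))
             (Linked-nth (L-linked (suc n)) (length-L (suc n)))

  limit-visits-last : ∀ k {xs y} → L k ≡ xs ∷ʳ y → k ≤ length xs × limit (length xs) ≡ y
  limit-visits-last k {xs} {y} Lk≡ = m<1+n⇒m≤n k<1+∣xs∣ , (begin
    limit (length xs)              ≡⟨ nth-L≡limit k ∣xs∣<∣Lk∣ ⟨
    nth d (L k) (length xs)        ≡⟨ cong (λ ys → nth d ys (length xs)) Lk≡ ⟩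
    nth d (xs ∷ʳ y) (length xs)    ≡⟨ nth-∷ʳ-length xs ⟩
    y                              ∎)
    where
    ∣Lk∣≡ : length (L k) ≡ suc (length xs)
    ∣Lk∣≡ = trans (cong length Lk≡) (trans (length-++ xs) (+-comm (length xs) 1))
    k<1+∣xs∣ : k < suc (length xs)
    k<1+∣xs∣ = subst (k <_) ∣Lk∣≡ (length-L k)
    ∣xs∣<∣Lk∣ : length xs < length (L k)
    ∣xs∣<∣Lk∣ = subst (length xs <_) (sym ∣Lk∣≡) (n<1+n (length xs))

module _ {V : Set} {R : V → V → Set} where

  infixr 5 _++ᵂ_

  _++ᵂ_ : ∀ {x y z} → Walk R x y → Walk R y z → Walk R x z
  []       ++ᵂ w₂ = w₂
  (e ∷ w₁) ++ᵂ w₂ = e ∷ (w₁ ++ᵂ w₂)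

  tailVerts : ∀ {x y} → Walk R x y → List V
  tailVerts []      = []
  tailVerts (_ ∷ w) = verts R w

  verts≡∷tailVerts : ∀ {x y} (w : Walk R x y) → verts R w ≡ x ∷ tailVerts w
  verts≡∷tailVerts []      = refl
  verts≡∷tailVerts (_ ∷ _) = refl

  verts-nonempty : ∀ {x y} (w : Walk R x y) → 0 < length (verts R w)
  verts-nonempty []      = s≤s z≤n
  verts-nonempty (_ ∷ _) = s≤s z≤n

  verts-∷ʳ : ∀ {x y} (w : Walk R x y) → Σ (List V) λ xs → verts R w ≡ xs ∷ʳ y
  verts-∷ʳ []          = [] , refl
  verts-∷ʳ {x} (_ ∷ w) = Product.map (x ∷_) (cong (x ∷_)) (verts-∷ʳ w)

  start∈verts : ∀ {x y} (w : Walk R x y) → x ∈ verts R w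
  start∈verts []      = here refl
  start∈verts (_ ∷ _) = here refl

  end∈verts : ∀ {x y} (w : Walk R x y) → y ∈ verts R w
  end∈verts []      = here refl
  end∈verts (_ ∷ w) = there (end∈verts w)

  verts-linked : ∀ {x y} (w : Walk R x y) → Linked R (verts R w)
  verts-linked []           = [-]
  verts-linked (e ∷ [])     = e ∷ [-]
  verts-linked (e ∷ f ∷ w) = e ∷ verts-linked (f ∷ w)

  verts-++ᵂ : ∀ {x y z} (w₁ : Walk R x y) (w₂ : Walk R y z) →
              verts R (w₁ ++ᵂ w₂) ≡ verts R w₁ ++ tailVerts w₂
  verts-++ᵂ []           w₂ = verts≡∷tailVerts w₂
  verts-++ᵂ {x} (e ∷ w₁) w₂ = cong (x ∷_) (verts-++ᵂ w₁ w₂)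

  ∈-++ᵂ⁺ˡ : ∀ {x y z u} (w₁ : Walk R x y) {w₂ : Walk R y z} →
            u ∈ verts R w₁ → u ∈ verts R (w₁ ++ᵂ w₂)
  ∈-++ᵂ⁺ˡ []       {w₂} (here refl) = start∈verts w₂
  ∈-++ᵂ⁺ˡ (e ∷ w₁) (here eq)        = here eq
  ∈-++ᵂ⁺ˡ (e ∷ w₁) (there u∈w₁)     = there (∈-++ᵂ⁺ˡ w₁ u∈w₁)

  ∈-++ᵂ⁺ʳ : ∀ {x y z u} (w₁ : Walk R x y) {w₂ : Walk R y z} →
            u ∈ verts R w₂ → u ∈ verts R (w₁ ++ᵂ w₂)
  ∈-++ᵂ⁺ʳ []       u∈w₂ = u∈w₂
  ∈-++ᵂ⁺ʳ (e ∷ w₁) u∈w₂ = there (∈-++ᵂ⁺ʳ w₁ u∈w₂)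

  ∈-++ᵂ⁻ : ∀ {x y z u} (w₁ : Walk R x y) {w₂ : Walk R y z} →
           u ∈ verts R (w₁ ++ᵂ w₂) → u ∈ verts R w₁ ⊎ u ∈ verts R w₂
  ∈-++ᵂ⁻ []       u∈w          = inj₂ u∈w
  ∈-++ᵂ⁻ (e ∷ w₁) (here eq)    = inj₁ (here eq)
  ∈-++ᵂ⁻ (e ∷ w₁) (there u∈w) = Sum.map₁ there (∈-++ᵂ⁻ w₁ u∈w)

  Unique-++ᵂ⁻ˡ : ∀ {x y z} (w₁ : Walk R x y) {w₂ : Walk R y z} →
                 Unique (verts R (w₁ ++ᵂ w₂)) → Unique (verts R w₁)
  Unique-++ᵂ⁻ˡ []       _        = [] ∷ []
  Unique-++ᵂ⁻ˡ (e ∷ w₁) (x∉ ∷ w!) =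
    All.anti-mono (∈-++ᵂ⁺ˡ w₁) x∉ ∷ Unique-++ᵂ⁻ˡ w₁ w!

  Unique-++ᵂ⁻ʳ : ∀ {x y z} (w₁ : Walk R x y) {w₂ : Walk R y z} →
                 Unique (verts R (w₁ ++ᵂ w₂)) → Unique (verts R w₂)
  Unique-++ᵂ⁻ʳ []       w!       = w!
  Unique-++ᵂ⁻ʳ (e ∷ w₁) (_ ∷ w!) = Unique-++ᵂ⁻ʳ w₁ w!

  split : ∀ {x y u} (w : Walk R x y) → u ∈ verts R w →
          Σ (Walk R x u) λ w₁ → Σ (Walk R u y) λ w₂ → w ≡ w₁ ++ᵂ w₂
  split []      (here refl)  = [] , [] , refl
  split (e ∷ w) (here refl)  = [] , e ∷ w , refl
  split (e ∷ w) (there u∈w) with split w u∈w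
  ... | w₁ , w₂ , refl = e ∷ w₁ , w₂ , refl

  module _ (symR : ∀ {x y} → R x y → R y x) where

    reverse : ∀ {x y} → Walk R x y → Walk R y x
    reverse []      = []
    reverse (e ∷ w) = reverse w ++ᵂ symR e ∷ []

    ∈-reverse : ∀ {x y u} (w : Walk R x y) → u ∈ verts R (reverse w) → u ∈ verts R w
    ∈-reverse []      u∈ = u∈
    ∈-reverse (e ∷ w) u∈ with ∈-++ᵂ⁻ (reverse w) u∈
    ... | inj₁ u∈w               = there (∈-reverse w u∈w)
    ... | inj₂ (here refl)       = there (start∈verts w)
    ... | inj₂ (there (here eq)) = here eq

    path-avoiding⇒HasCycle : ∀ {x a b} → R x a → R x b → a ≢ b →
                             (p : Path R a b) → x ∉ verts R (proj₁ p) → HasCycle R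
    path-avoiding⇒HasCycle _ _ a≢b ([] , _) _ = ⊥-elim (a≢b refl)
    path-avoiding⇒HasCycle {x} {b = b} xa xb _ (p@(_ ∷ _) , p!) x∉p =
      b , x , symR xb , (xa ∷ p , All.¬Any⇒All¬ _ x∉p ∷ p!) , s≤s (s≤s z≤n)

module _ (em : ExcludedMiddle 0ℓ) {V : Set} {R : V → V → Set} where

  -- Loop erasure, deciding membership in the path by excluded middle.
  to-path : ∀ {x y} (w : Walk R x y) → Σ (Path R x y) λ p → verts R (proj₁ p) ⊆ verts R w
  to-path []           = ([] , [] ∷ []) , λ u∈ → u∈
  to-path {x} (e ∷ w) with to-path w
  ... | (p , p!) , p⊆w with em {x ∈ verts R p}
  ...   | no x∉p  = (e ∷ p , All.¬Any⇒All¬ _ x∉p ∷ p!) ,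
                    λ { (here eq) → here eq ; (there u∈p) → there (p⊆w u∈p) }
  ...   | yes x∈p with split p x∈p
  ...     | p₁ , p₂ , refl = (p₂ , Unique-++ᵂ⁻ʳ p₁ p!) , there ∘ p⊆w ∘ ∈-++ᵂ⁺ʳ p₁

  module _ (symR : ∀ {x y} → R x y → R y x) (acyclic : Acyclic R) where

    path-unique : ∀ {x y} (p q : Walk R x y) → Unique (verts R p) → Unique (verts R q) →
                  verts R p ≡ verts R q
    path-unique []      []      _  _  = refl
    path-unique []      (e ∷ q) _  q! = ⊥-elim (Unique[x∷xs]⇒x∉xs q! (end∈verts q))
    path-unique (e ∷ p) []      p! _  = ⊥-elim (Unique[x∷xs]⇒x∉xs p! (end∈verts p))
    path-unique {x} (_∷_ {y = a} xa p) (_∷_ {y = b} xb q) p!@(_ ∷ p′!) q!@(_ ∷ q′!)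
      with em {a ≡ b}
    ... | yes refl = cong (x ∷_) (path-unique p q p′! q′!)
    ... | no a≢b   = ⊥-elim (acyclic (path-avoiding⇒HasCycle symR xa xb a≢b a⇝b x∉a⇝b))
      where
      a⇝b : Path R a b
      a⇝b = proj₁ (to-path (p ++ᵂ reverse symR q))
      x∉a⇝b : x ∉ verts R (proj₁ a⇝b)
      x∉a⇝b x∈ with ∈-++ᵂ⁻ p (proj₂ (to-path (p ++ᵂ reverse symR q)) x∈)
      ... | inj₁ x∈p  = Unique[x∷xs]⇒x∉xs p! x∈p
      ... | inj₂ x∈q′ = Unique[x∷xs]⇒x∉xs q! (∈-reverse symR q x∈q′)

    path-≺ : ∀ {x u v} (p : Path R x u) (q : Path R x v) →
             u ∈ verts R (proj₁ q) → u ≢ v → verts R (proj₁ p) ≺ verts R (proj₁ q)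
    path-≺ (p , p!) (q , q!) u∈q u≢v with split q u∈q
    ... | q₁ , []     , refl = ⊥-elim (u≢v refl)
    ... | q₁ , e ∷ q₂ , refl = _ , tailVerts q₂ , (begin
      verts R (q₁ ++ᵂ e ∷ q₂)     ≡⟨ verts-++ᵂ q₁ (e ∷ q₂) ⟩
      verts R q₁ ++ verts R q₂    ≡⟨ cong₂ _++_ (path-unique q₁ p (Unique-++ᵂ⁻ˡ q₁ q!) p!)
                                                (verts≡∷tailVerts q₂) ⟩
      verts R p ++ _ ∷ tailVerts q₂ ∎)

module _ {A : Set} {P : A → Set} {S : A → A → Set}
         (next : ∀ {x} → P x → Σ A λ y → S x y × P y) where

  dependent-chain : Σ A P → ℕ → Σ A P
  dependent-chain s zero    = s
  dependent-chain s (suc k) = Product.map₂ proj₂ (next (proj₂ (dependent-chain s k)))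

  dependent-chain-step : ∀ s k →
                         S (proj₁ (dependent-chain s k)) (proj₁ (dependent-chain s (suc k)))
  dependent-chain-step s k = proj₁ (proj₂ (next (proj₂ (dependent-chain s k))))

module _ (G : Graph) where
  open Graph G using (V)

  PassesThrough : Ray G → (ℕ → V) → Set
  PassesThrough ρ v = ∀ k → Σ ℕ λ n → k ≤ n × Ray.seq ρ n ≡ v k

  OppositeDegrees : V → V → Set
  OppositeDegrees a b =
    (FiniteDegree G a × InfiniteDegree G b) ⊎ (InfiniteDegree G a × FiniteDegree G b)

  infinitely-often : ∀ (P : V → Set) (ρ : Ray G) {v : ℕ → V} → PassesThrough ρ v →
                     (∀ k → P (v k) ⊎ P (v (suc k))) → ∀ N → Σ ℕ λ n → N ≤ n × P (Ray.seq ρ n)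
  infinitely-often P ρ {v} passes P-often N = [ visit N , weaken ∘ visit (suc N) ]′ (P-often N)
    where
    visit : ∀ k → P (v k) → Σ ℕ λ n → k ≤ n × P (Ray.seq ρ n)
    visit k P-vk with passes k
    ... | n , k≤n , seq≡ = n , k≤n , subst P (sym seq≡) P-vk
    weaken : (Σ ℕ λ n → suc N ≤ n × P (Ray.seq ρ n)) → Σ ℕ λ n → N ≤ n × P (Ray.seq ρ n)
    weaken (n , N<n , P-n) = n , ≤-trans (n≤1+n N) N<n , P-n

  alternating-through : (ρ : Ray G) {v : ℕ → V} → PassesThrough ρ v →
                        (∀ k → OppositeDegrees (v k) (v (suc k))) → Alternating G ρ
  alternating-through ρ passes opposite =
    infinitely-often (FiniteDegree G) ρ passes (Sum.map proj₁ proj₂ ∘ opposite) ,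
    infinitely-often (InfiniteDegree G) ρ passes ([ inj₂ ∘ proj₂ , inj₁ ∘ proj₁ ]′ ∘ opposite)

module _ (em : ExcludedMiddle 0ℓ) (G : Graph) (T : SpanningTree G) (r : Graph.V G) where
  open Graph G using (V)
  open SpanningTree T

  _<T_ : V → V → Set
  u <T v = _≤T_ G T r u v × u ≢ v

  ray-through : (v : ℕ → V) → (∀ k → v k <T v (suc k)) →
                Σ (Ray G) λ ρ → PassesThrough G ρ v
  ray-through v v-increasing = ρ , passes
    where
    path-to : ∀ k → Path ET r (v k)
    path-to k = connT r (v k)

    L : ℕ → List V
    L k = verts ET (proj₁ (path-to k))

    L-≺ : ∀ k → L k ≺ L (suc k)
    L-≺ k with v-increasing k
    ... | (q , vk∈q) , vk≢vk+1 =
      subst (L k ≺_) (path-unique em symT acyclic (proj₁ q) (proj₁ (path-to (suc k)))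
                                                  (proj₂ q) (proj₂ (path-to (suc k))))
            (path-≺ em symT acyclic (path-to k) q vk∈q vk≢vk+1)

    open PrefixLimit r L (verts-nonempty (proj₁ (path-to 0))) L-≺

    ρ : Ray G
    ρ = record
      { seq = limit
      ; inj = limit-injective (proj₂ ∘ path-to)
      ; adj = limit-linked (Linked.map sub ∘ verts-linked ∘ proj₁ ∘ path-to)
      }

    passes : PassesThrough G ρ v
    passes k with verts-∷ʳ (proj₁ (path-to k))
    ... | xs , Lk≡ = length xs , limit-visits-last k Lk≡

  Unranked : V → Set
  Unranked v = ¬ HasRank G T r v

  unranked-above : ∀ (P : V → Set) {v} →
                   ¬ (∀ u → _≤T_ G T r v u → u ≢ v → P u → HasRank G T r u) →
                   Σ V λ u → v <T u × P u × Unranked u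
  unranked-above P {v} ¬ranked with em {Σ V λ u → v <T u × P u × Unranked u}
  ... | yes found = found
  ... | no none   = ⊥-elim (¬ranked λ u v≤u u≢v P-u →
                      decidable-stable em λ u∉ → none (u , (v≤u , ≢-sym u≢v) , P-u , u∉))

  unranked-step : ∀ {v} → Unranked v → Σ V λ u → (v <T u × OppositeDegrees G v u) × Unranked u
  unranked-step {v} v∉ with em {FiniteDegree G v}
  ... | yes fin with unranked-above (InfiniteDegree G) (v∉ ∘ rankFin fin)
  ...   | u , v<u , inf , u∉ = u , (v<u , inj₁ (fin , inf)) , u∉
  unranked-step {v} v∉ | no inf with unranked-above (FiniteDegree G) (v∉ ∘ rankInf inf)
  ...   | u , v<u , fin , u∉ = u , (v<u , inj₂ (inf , fin)) , u∉

lemma3p2 : ExcludedMiddle 0ℓ →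
    (G : Graph) → Countable (Graph.V G) → ConnectedGraph G → NoAlternatingRay G →
    (T : SpanningTree G) (r : Graph.V G) → Normal G T r →
    ∀ v → HasRank G T r v
lemma3p2 em G _ _ no-alternating-ray T r _ v = decidable-stable em λ v∉ →
  let chain = dependent-chain (unranked-step em G T r) (v , v∉)
      step  = dependent-chain-step (unranked-step em G T r) (v , v∉)
      ρ , passes = ray-through em G T r (proj₁ ∘ chain) (proj₁ ∘ step)
  in  no-alternating-ray (ρ , alternating-through G ρ passes (proj₂ ∘ step))
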